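{- If $G$ is the incidence graph of a $\mathrm{BIBD}(v,b,r,k,1)$, then $\zeta(G) \le 2r + k - 3$.
   Context: A $\mathrm{BIBD}(v,b,r,k,\lambda)$ is a set $X$ of $v$ points together with a collection $\mathcal{B}$ of $b$ blocks (subsets of $X$) such that every block has size $k$, every point lies in exactly $r$ blocks, and every pair of distinct points lies in exactly $\lambda$ blocks. Its incidence graph is the bipartite graph on $X \cup \mathcal{B}$ with $x \sim B$ iff $x \in B$. Localization game on a connected graph $G$ with $k$ cops: the robber chooses a starting vertex, invisible to the cops. Each round the cops choose any $k$ vertices (no adjacency restriction) and each learns its distance to the robber; the cops win if after finitely many rounds they determine the robber's vertex uniquely; otherwise the robber moves to a neighbour or stays. The robber knows the cops' strategy. $\zeta(G)$ is the least $k$ for which $k$ cops can guarantee capture. -}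

module Defs where

open import Level using (Level; 0ℓ) renaming (suc to lsuc)
open import Data.Nat using (ℕ; zero; suc; _+_; _*_; _∸_; _≤_; _<_)
open import Data.Bool using (Bool; true; false; _∧_)
open import Data.Fin using (Fin)
open import Data.Fin.Subset using (Subset; ∣_∣)
open import Data.Vec using (Vec; lookup; tabulate)
open import Data.Sum using (_⊎_; inj₁; inj₂)
open import Data.Product using (Σ; ∃; ∃-syntax; _×_; _,_)
open import Data.Empty using (⊥)
open import Data.Unit using (⊤)
open import Relation.Nullary using (¬_)
open import Relation.Binary.PropositionalEquality using (_≡_; _≢_)
open import Function.Bundles using (_⇔_)

-- Balanced incomplete block designs
-- Points are Fin v, blocks are indexed by Fin b (a collection, repeats
-- allowed); block j is the subset  blocks j  of the points.

record IsBIBD (v b r k lam : ℕ) (blocks : Fin b → Subset v) : Set where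
  field
    blockSize  : ∀ (j : Fin b) → ∣ blocks j ∣ ≡ k
    replication : ∀ (x : Fin v) →
      ∣ tabulate (λ j → lookup (blocks j) x) ∣ ≡ r
    balance    : ∀ (x y : Fin v) → x ≢ y →
      ∣ tabulate (λ j → lookup (blocks j) x ∧ lookup (blocks j) y) ∣ ≡ lam

record Graph : Set₁ where
  field
    V   : Set
    Adj : V → V → Set

IncAdj : ∀ {v b} → (Fin b → Subset v) → (Fin v ⊎ Fin b) → (Fin v ⊎ Fin b) → Set
IncAdj bl (inj₁ x) (inj₂ j) = lookup (bl j) x ≡ true
IncAdj bl (inj₂ j) (inj₁ x) = lookup (bl j) x ≡ true
IncAdj bl (inj₁ _) (inj₁ _) = ⊥
IncAdj bl (inj₂ _) (inj₂ _) = ⊥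

incidenceGraph : ∀ {v b} → (Fin b → Subset v) → Graph
incidenceGraph {v} {b} bl = record { V = Fin v ⊎ Fin b ; Adj = IncAdj bl }

module _ (G : Graph) where
  open Graph G

  -- Closed neighbourhood of a set of vertices (robber stays or moves
  -- to a neighbour).
  N[_] : (V → Set) → (V → Set)
  N[ S ] w = ∃[ z ] (S z × (w ≡ z ⊎ Adj z w))

  Ball : ℕ → V → V → Set
  Ball zero u w = w ≡ u
  Ball (suc d) u = N[ Ball d u ]

  IsDist : V → V → ℕ → Set
  IsDist u w d = Ball d u w × (∀ e → e < d → ¬ Ball e u w)

  Connected : Set
  Connected = ∀ u w → ∃[ d ] Ball d u w

  -- State: the set S of vertices where the robber may currently be.
  -- Each round the cops probe m vertices  cs ; the robber at x answers
  -- the distance vector, so the cops learn that the robber lies in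
  --   Class S cs x = { y ∈ S | dist(cs i, y) = dist(cs i, x) for all i }.
  -- If this class has at most one vertex, the robber is located; otherwise
  -- the robber moves (or stays) and the new state is N[ Class S cs x ].
  Class : ∀ {m} → (V → Set) → Vec V m → V → (V → Set)
  Class S cs x y = S y × (∀ i d → IsDist (lookup cs i) y d ⇔ IsDist (lookup cs i) x d)

  AtMostOne : (V → Set) → Set
  AtMostOne C = ∀ y z → C y → C z → y ≡ z

  -- CopsWin m S : m cops have a strategy that locates the robber
  -- in finitely many rounds, whatever the (strategy-aware) robber does,
  -- starting from possible-position set S (inductive = finitely many rounds).
  data CopsWin (m : ℕ) : (V → Set) → Set₁ where
    probe : ∀ {S} (cs : Vec V m) →
            (∀ x → S x → AtMostOne (Class S cs x) ⊎ CopsWin m N[ Class S cs x ]) →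
            CopsWin m S

  CanCapture : ℕ → Set₁
  CanCapture m = CopsWin m (λ _ → ⊤)

  ζ≤ : ℕ → Set₁
  ζ≤ n = ∃[ m ] (m ≤ n × CanCapture m)

-- Fix points p ≠ q, let B be the block through both, and probe the blocks
-- through p or q other than B and the points of B other than p:
-- (r − 1) + (r − 1) + (k − 1) cops.  The probe at q tells points from blocks.
-- A point u off B is located: the blocks through p, u and through q, u are
-- probed, and a second point on both would make them one block containing p
-- and q, i.e. B.  A point of B is probed or equal to p, and a block through p
-- is probed or equal to B, the only unprobed block through q.  So a robber
-- that stays hidden sits on a block avoiding p, and after its move every block
-- it may occupy still avoids p, since the neighbours of a block are points.
-- Probing with p = v − 1, …, 1, 0 in turn leaves it no block to hide on.

module Submission where

open import Defs
open import Data.Bool using (Bool; true; _∧_) renaming (_≟_ to _≟ᵇ_)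
open import Data.Empty using (⊥; ⊥-elim)
open import Data.Fin using (Fin; zero; suc; toℕ; fromℕ<; _≟_)
open import Data.Fin.Properties using (toℕ<n; toℕ-fromℕ<; toℕ-injective)
open import Data.Fin.Subset using (Subset; ∣_∣; _∈_; _-_; Nonempty; inside; outside)
open import Data.Fin.Subset.Properties
  using (∣p∣≤n; ∣⊥∣≡0; Empty-unique; nonempty?; x∈p⇒∣p-x∣<∣p∣; x∈p∧x≢y⇒x∈p-y)
open import Data.Nat using (ℕ; zero; suc; _+_; _*_; _∸_; _≤_; _<_; z≤n; s≤s; s≤s⁻¹; _≤?_)
open import Data.Nat.Properties
  using (≤-refl; ≤-trans; ≤-reflexive; <⇒≤; ≤∧≢⇒<; ≰⇒>; +-mono-≤; m+n≤o⇒m≤o∸n; n<1⇒n≡0)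
open import Data.Nat.Tactic.RingSolver using (solve-∀)
open import Data.Product using (∃-syntax; _×_; _,_; proj₁; proj₂)
open import Data.Sum as Sum using (_⊎_; inj₁; inj₂)
open import Data.Sum.Properties using (inj₂-injective)
open import Data.Unit using (⊤)
open import Data.Vec using (Vec; []; _∷_; here; there; lookup; tabulate; map; _++_; padRight)
open import Data.Vec.Properties using (lookup∘tabulate; lookup⇒[]=; []=⇒lookup)
open import Data.Vec.Membership.Propositional using () renaming (_∈_ to _∈ᵛ_)
open import Data.Vec.Membership.Propositional.Properties using (∈-map⁺; ∈-++⁺ˡ; ∈-++⁺ʳ)
open import Data.Vec.Relation.Unary.Any as Any using (index)
open import Data.Vec.Relation.Unary.Any.Properties using (lookup-index)
open import Function using (_∘_)
open import Function.Bundles using (_⇔_; Equivalence)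
import Function.Properties.Equivalence as ⇔
open import Relation.Nullary using (¬_; Dec; yes; no; contradiction)
open import Relation.Binary.PropositionalEquality
  using (_≡_; _≢_; refl; sym; trans; cong; subst; subst₂)

∧≡true⁻ : ∀ {a b : Bool} → a ∧ b ≡ true → a ≡ true × b ≡ true
∧≡true⁻ {true} {true} refl = refl , refl

∧≡true⁺ : ∀ {a b : Bool} → a ≡ true → b ≡ true → a ∧ b ≡ true
∧≡true⁺ refl refl = refl

other-than : ∀ {n} → 1 < n → (i : Fin n) → ∃[ j ] i ≢ j
other-than (s≤s (s≤s _)) zero    = suc zero , λ ()
other-than (s≤s (s≤s _)) (suc i) = zero , λ ()

module _ {n : ℕ} where

  0<∣p∣⇒Nonempty : (p : Subset n) → 0 < ∣ p ∣ → Nonempty p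
  0<∣p∣⇒Nonempty p 0<∣p∣ with nonempty? p
  ... | yes p≢∅ = p≢∅
  ... | no  p≡∅ with subst (0 <_) (trans (cong ∣_∣ (Empty-unique p≡∅)) (∣⊥∣≡0 n)) 0<∣p∣
  ...   | ()

  x∈p⇒0<∣p∣ : ∀ {p : Subset n} {x} → x ∈ p → 0 < ∣ p ∣
  x∈p⇒0<∣p∣ x∈p = ≤-trans (s≤s z≤n) (x∈p⇒∣p-x∣<∣p∣ x∈p)

  x,y∈p∧x≢y⇒1<∣p∣ : ∀ {p : Subset n} {x y} → x ∈ p → y ∈ p → x ≢ y → 1 < ∣ p ∣
  x,y∈p∧x≢y⇒1<∣p∣ x∈p y∈p x≢y =
    ≤-trans (s≤s (x∈p⇒0<∣p∣ (x∈p∧x≢y⇒x∈p-y y∈p (x≢y ∘ sym)))) (x∈p⇒∣p-x∣<∣p∣ x∈p)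

elements : ∀ {n} (p : Subset n) → Vec (Fin n) ∣ p ∣
elements []            = []
elements (inside ∷ p)  = zero ∷ map suc (elements p)
elements (outside ∷ p) = map suc (elements p)

∈-elements : ∀ {n} {p : Subset n} {x} → x ∈ p → x ∈ᵛ elements p
∈-elements {p = inside ∷ p}  here        = Any.here refl
∈-elements {p = inside ∷ p}  (there x∈p) = Any.there (∈-map⁺ suc (∈-elements x∈p))
∈-elements {p = outside ∷ p} (there x∈p) = ∈-map⁺ suc (∈-elements x∈p)

∈-padRight⁺ : ∀ {A : Set} {m n} (m≤n : m ≤ n) (a : A) {x} {xs : Vec A m} →
              x ∈ᵛ xs → x ∈ᵛ padRight m≤n a xs
∈-padRight⁺ (s≤s m≤n) a (Any.here refl)  = Any.here refl
∈-padRight⁺ (s≤s m≤n) a (Any.there x∈xs) = Any.there (∈-padRight⁺ m≤n a x∈xs)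

a<r∧c<r∧d<k⇒a+c+d≤2r+k∸3 : ∀ {a c d r k} → a < r → c < r → d < k → a + (c + d) ≤ 2 * r + k ∸ 3
a<r∧c<r∧d<k⇒a+c+d≤2r+k∸3 {a} {c} {d} {r} {k} a<r c<r d<k =
  m+n≤o⇒m≤o∸n (a + (c + d))
    (subst₂ _≤_ (shift a c d) (double r k) (+-mono-≤ (+-mono-≤ a<r c<r) d<k))
  where
  shift : ∀ a c d → suc a + suc c + suc d ≡ a + (c + d) + 3
  shift = solve-∀
  double : ∀ r k → r + r + k ≡ 2 * r + k
  double = solve-∀

AtMostOne⇒CopsWin : ∀ (G : Graph) {S} → AtMostOne G S → CopsWin G 0 S
AtMostOne⇒CopsWin G S≤1 = probe [] λ _ _ → inj₁ λ y z (Sy , _) (Sz , _) → S≤1 y z Sy Sz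

module LooplessGraph (G : Graph) (loopless : ∀ u → ¬ Graph.Adj G u u) where
  open Graph G

  dist-refl : ∀ u → IsDist G u u 0
  dist-refl u = refl , λ _ ()

  Adj⇒dist1 : ∀ {u w} → Adj u w → IsDist G u w 1
  Adj⇒dist1 {u} uw = (u , refl , inj₂ uw) , λ where
    zero    _         refl → loopless u uw
    (suc _) (s≤s ())

  dist1⇒Adj : ∀ {u w} → IsDist G u w 1 → Adj u w
  dist1⇒Adj ((_ , refl , inj₂ uw) , _)             = uw
  dist1⇒Adj ((_ , refl , inj₁ refl) , not-closer) = ⊥-elim (not-closer 0 (s≤s z≤n) refl)

  module Probing {m} (cops : Vec V m) where

    _≈_ : V → V → Set
    x ≈ y = ∀ i d → IsDist G (lookup cops i) y d ⇔ IsDist G (lookup cops i) x d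

    ≈-refl : ∀ {x} → x ≈ x
    ≈-refl i d = ⇔.refl

    ≈-sym : ∀ {x y} → x ≈ y → y ≈ x
    ≈-sym x≈y i d = ⇔.sym (x≈y i d)

    ≈-dist : ∀ {c x y d} → c ∈ᵛ cops → x ≈ y → IsDist G c x d → IsDist G c y d
    ≈-dist {x = x} {y} {d} c∈ x≈y =
      subst (λ c → IsDist G c x d → IsDist G c y d) (sym (lookup-index c∈))
        (Equivalence.from (x≈y (index c∈) d))

    ≈-Adj : ∀ {c x y} → c ∈ᵛ cops → x ≈ y → Adj c x → Adj c y
    ≈-Adj c∈ x≈y cx = dist1⇒Adj (≈-dist c∈ x≈y (Adj⇒dist1 cx))

    Located : V → Set
    Located x = ∀ y → x ≈ y → y ≡ x

    located-sym : ∀ {x y} → Located y → x ≈ y → y ≡ x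
    located-sym located x≈y = sym (located _ (≈-sym x≈y))

    cop-located : ∀ {c} → c ∈ᵛ cops → Located c
    cop-located {c} c∈ _ c≈y = proj₁ (≈-dist c∈ c≈y (dist-refl c))

    Located⇒AtMostOne : ∀ {S x} → Located x → AtMostOne G (Class G S cops x)
    Located⇒AtMostOne located y z (_ , x≈y) (_ , x≈z) = trans (located y x≈y) (sym (located z x≈z))

module Design {v b r k : ℕ} (blocks : Fin b → Subset v) (bibd : IsBIBD v b r k 1 blocks) where
  open IsBIBD bibd

  _∈ᵇ_ : Fin v → Fin b → Set
  x ∈ᵇ j = lookup (blocks j) x ≡ true

  _∈ᵇ?_ : ∀ x j → Dec (x ∈ᵇ j)
  x ∈ᵇ? j = lookup (blocks j) x ≟ᵇ true

  ∈ᵇ⇒∈ : ∀ {x j} → x ∈ᵇ j → x ∈ blocks j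
  ∈ᵇ⇒∈ {x} {j} = lookup⇒[]= x (blocks j)

  x∈j∧u∉j⇒x≢u : ∀ {x u j} → x ∈ᵇ j → ¬ u ∈ᵇ j → x ≢ u
  x∈j∧u∉j⇒x≢u x∈j u∉j refl = u∉j x∈j

  u∈j∧u∉j′⇒j≢j′ : ∀ {u j j′} → u ∈ᵇ j → ¬ u ∈ᵇ j′ → j ≢ j′
  u∈j∧u∉j′⇒j≢j′ u∈j u∉j′ refl = u∉j′ u∈j

  blocksThrough : Fin v → Subset b
  blocksThrough x = tabulate (λ j → lookup (blocks j) x)

  ∈-blocksThrough : ∀ {x j} → x ∈ᵇ j → j ∈ blocksThrough x
  ∈-blocksThrough {x} {j} x∈j = lookup⇒[]= j _ (trans (lookup∘tabulate _ j) x∈j)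

  blocksThroughBoth : Fin v → Fin v → Subset b
  blocksThroughBoth x y = tabulate (λ j → lookup (blocks j) x ∧ lookup (blocks j) y)

  ∈-blocksThroughBoth : ∀ {x y j} → x ∈ᵇ j → y ∈ᵇ j → j ∈ blocksThroughBoth x y
  ∈-blocksThroughBoth {j = j} x∈j y∈j =
    lookup⇒[]= j _ (trans (lookup∘tabulate _ j) (∧≡true⁺ x∈j y∈j))

  block-through : ∀ {x y} → x ≢ y → ∃[ j ] (x ∈ᵇ j × y ∈ᵇ j)
  block-through {x} {y} x≢y
    with 0<∣p∣⇒Nonempty (blocksThroughBoth x y) (≤-reflexive (sym (balance x y x≢y)))
  ... | j , j∈ = j , ∧≡true⁻ (trans (sym (lookup∘tabulate _ j)) ([]=⇒lookup j∈))

  block-through-unique : ∀ {x y j j′} → x ≢ y → x ∈ᵇ j → y ∈ᵇ j → x ∈ᵇ j′ → y ∈ᵇ j′ → j ≡ j′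
  block-through-unique {x} {y} {j} {j′} x≢y x∈j y∈j x∈j′ y∈j′ with j ≟ j′
  ... | yes j≡j′ = j≡j′
  ... | no  j≢j′
    with subst (1 <_) (balance x y x≢y)
           (x,y∈p∧x≢y⇒1<∣p∣ (∈-blocksThroughBoth x∈j y∈j) (∈-blocksThroughBoth x∈j′ y∈j′) j≢j′)
  ...   | s≤s ()

  point-of : 0 < k → ∀ j → ∃[ x ] x ∈ᵇ j
  point-of 0<k j with 0<∣p∣⇒Nonempty (blocks j) (subst (0 <_) (sym (blockSize j)) 0<k)
  ... | x , x∈j = x , []=⇒lookup x∈j

  v≤1⇒¬block : v ≤ 1 → 1 < k → Fin b → ⊥
  v≤1⇒¬block v≤1 1<k j with ≤-trans 1<k (≤-trans (subst (_≤ v) (blockSize j) (∣p∣≤n (blocks j))) v≤1)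
  ... | s≤s ()

  G : Graph
  G = incidenceGraph blocks

  V : Set
  V = Fin v ⊎ Fin b

  loopless : ∀ u → ¬ IncAdj blocks u u
  loopless (inj₁ _) ()
  loopless (inj₂ _) ()

  open LooplessGraph G loopless

  point-dist2 : ∀ {x y} → x ≢ y → IsDist G (inj₁ x) (inj₁ y) 2
  point-dist2 {x} {y} x≢y with block-through x≢y
  ... | j , x∈j , y∈j = (inj₂ j , (inj₁ x , refl , inj₂ x∈j) , inj₂ y∈j) , not-closer
    where
    not-closer : ∀ e → e < 2 → ¬ Ball G e (inj₁ x) (inj₁ y)
    not-closer zero          _ refl                  = x≢y refl
    not-closer (suc zero)    _ (_ , refl , inj₁ refl) = x≢y refl
    not-closer (suc (suc _)) (s≤s (s≤s ()))

  ¬point-block-dist2 : ∀ {x j} → ¬ IsDist G (inj₁ x) (inj₂ j) 2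
  ¬point-block-dist2 {x} {j} ((z , (_ , refl , xz) , zj) , not-closer) =
    not-closer 1 (s≤s (s≤s z≤n)) (ball1 z xz zj)
    where
    ball1 : ∀ z → z ≡ inj₁ x ⊎ IncAdj blocks (inj₁ x) z → inj₂ j ≡ z ⊎ IncAdj blocks z (inj₂ j) →
            Ball G 1 (inj₁ x) (inj₂ j)
    ball1 _        (inj₁ refl) (inj₂ x∈j) = inj₁ x , refl , inj₂ x∈j
    ball1 _        (inj₂ x∈j)  (inj₁ refl) = inj₁ x , refl , inj₂ x∈j
    ball1 (inj₂ _) (inj₂ _)    (inj₂ ())

  Avoids : Fin v → V → Set
  Avoids p (inj₁ _) = ⊥
  Avoids p (inj₂ j) = ¬ p ∈ᵇ j

  module Probe (p q : Fin v) (p≢q : p ≢ q) where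

    B : Fin b
    B = proj₁ (block-through p≢q)

    p∈B : p ∈ᵇ B
    p∈B = proj₁ (proj₂ (block-through p≢q))

    q∈B : q ∈ᵇ B
    q∈B = proj₂ (proj₂ (block-through p≢q))

    otherBlocksThrough : Fin v → Subset b
    otherBlocksThrough x = blocksThrough x - B

    otherPointsOfB : Subset v
    otherPointsOfB = blocks B - p

    ∣otherBlocksThrough∣<r : ∀ {x} → x ∈ᵇ B → ∣ otherBlocksThrough x ∣ < r
    ∣otherBlocksThrough∣<r {x} x∈B =
      subst (∣ otherBlocksThrough x ∣ <_) (replication x) (x∈p⇒∣p-x∣<∣p∣ (∈-blocksThrough x∈B))

    ∣otherPointsOfB∣<k : ∣ otherPointsOfB ∣ < k
    ∣otherPointsOfB∣<k = subst (∣ otherPointsOfB ∣ <_) (blockSize B) (x∈p⇒∣p-x∣<∣p∣ (∈ᵇ⇒∈ p∈B))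

    #candidates : ℕ
    #candidates = ∣ otherBlocksThrough p ∣ + (∣ otherBlocksThrough q ∣ + ∣ otherPointsOfB ∣)

    candidates : Vec V #candidates
    candidates = map inj₂ (elements (otherBlocksThrough p)) ++
                 map inj₂ (elements (otherBlocksThrough q)) ++
                 map inj₁ (elements otherPointsOfB)

    #candidates≤ : #candidates ≤ 2 * r + k ∸ 3
    #candidates≤ = a<r∧c<r∧d<k⇒a+c+d≤2r+k∸3
      (∣otherBlocksThrough∣<r p∈B) (∣otherBlocksThrough∣<r q∈B) ∣otherPointsOfB∣<k

    ∈-otherBlocksThrough : ∀ {x j} → x ∈ᵇ j → j ≢ B → j ∈ᵛ elements (otherBlocksThrough x)
    ∈-otherBlocksThrough x∈j j≢B = ∈-elements (x∈p∧x≢y⇒x∈p-y (∈-blocksThrough x∈j) j≢B)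

    -- Opaque: unfolding the padded vector in the case analyses below makes
    -- type checking blow up.
    opaque
      cops : Vec V (2 * r + k ∸ 3)
      cops = padRight #candidates≤ (inj₁ q) candidates

      candidate-cop : ∀ {c} → c ∈ᵛ candidates → c ∈ᵛ cops
      candidate-cop = ∈-padRight⁺ #candidates≤ (inj₁ q)

    open Probing cops public

    p-block-cop : ∀ {j} → p ∈ᵇ j → j ≢ B → inj₂ j ∈ᵛ cops
    p-block-cop p∈j j≢B = candidate-cop (∈-++⁺ˡ (∈-map⁺ inj₂ (∈-otherBlocksThrough p∈j j≢B)))

    q-block-cop : ∀ {j} → q ∈ᵇ j → j ≢ B → inj₂ j ∈ᵛ cops
    q-block-cop q∈j j≢B =
      candidate-cop (∈-++⁺ʳ (map inj₂ (elements (otherBlocksThrough p)))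
        (∈-++⁺ˡ (∈-map⁺ inj₂ (∈-otherBlocksThrough q∈j j≢B))))

    B-point-cop : ∀ {w} → w ∈ᵇ B → w ≢ p → inj₁ w ∈ᵛ cops
    B-point-cop w∈B w≢p = candidate-cop (∈-++⁺ʳ (map inj₂ (elements (otherBlocksThrough p)))
      (∈-++⁺ʳ (map inj₂ (elements (otherBlocksThrough q)))
        (∈-map⁺ inj₁ (∈-elements (x∈p∧x≢y⇒x∈p-y (∈ᵇ⇒∈ w∈B) w≢p)))))

    q-cop : inj₁ q ∈ᵛ cops
    q-cop = B-point-cop q∈B (p≢q ∘ sym)

    ¬block≈point : ∀ {j w} → ¬ (inj₂ j ≈ inj₁ w)
    ¬block≈point {j} {w} j≈w with w ≟ q
    ... | yes refl = contradiction (located-sym (cop-located q-cop) j≈w) λ ()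
    ... | no  w≢q  = ¬point-block-dist2 (≈-dist q-cop (≈-sym j≈w) (point-dist2 (w≢q ∘ sym)))

    outside-B-located : ∀ {u} → ¬ u ∈ᵇ B → Located (inj₁ u)
    outside-B-located u∉B (inj₂ _) u≈j = ⊥-elim (¬block≈point (≈-sym u≈j))
    outside-B-located {u} u∉B (inj₁ w) u≈w with w ≟ u
    ... | yes refl = refl
    ... | no  w≢u
      with block-through (x∈j∧u∉j⇒x≢u p∈B u∉B) | block-through (x∈j∧u∉j⇒x≢u q∈B u∉B)
    ...   | D , p∈D , u∈D | E , q∈E , u∈E = ⊥-elim (u∈j∧u∉j′⇒j≢j′ u∈D u∉B D≡B)
      where
      D≡E : D ≡ E
      D≡E = block-through-unique (w≢u ∘ sym)
        u∈D (≈-Adj (p-block-cop p∈D (u∈j∧u∉j′⇒j≢j′ u∈D u∉B)) u≈w u∈D)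
        u∈E (≈-Adj (q-block-cop q∈E (u∈j∧u∉j′⇒j≢j′ u∈E u∉B)) u≈w u∈E)
      D≡B : D ≡ B
      D≡B = block-through-unique p≢q p∈D (subst (q ∈ᵇ_) (sym D≡E) q∈E) p∈B q∈B

    point-located : ∀ u → Located (inj₁ u)
    point-located u (inj₂ _) u≈j = ⊥-elim (¬block≈point (≈-sym u≈j))
    point-located u (inj₁ w) u≈w with u ∈ᵇ? B | w ∈ᵇ? B
    ... | no u∉B | _      = outside-B-located u∉B (inj₁ w) u≈w
    ... | yes _  | no w∉B = located-sym (outside-B-located w∉B) u≈w
    ... | yes u∈B | yes w∈B with u ≟ p | w ≟ p
    ...   | no u≢p   | _        = cop-located (B-point-cop u∈B u≢p) (inj₁ w) u≈w
    ...   | yes _    | no w≢p   = located-sym (cop-located (B-point-cop w∈B w≢p)) u≈w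
    ...   | yes refl | yes refl = refl

    B-located : Located (inj₂ B)
    B-located (inj₁ _) B≈w = ⊥-elim (¬block≈point B≈w)
    B-located (inj₂ j) B≈j with j ≟ B
    ... | yes refl = refl
    ... | no  j≢B  = located-sym (cop-located (q-block-cop (≈-Adj q-cop B≈j q∈B) j≢B)) B≈j

    p-block-located : ∀ {j} → p ∈ᵇ j → Located (inj₂ j)
    p-block-located {j} p∈j with j ≟ B
    ... | yes refl = B-located
    ... | no  j≢B  = cop-located (p-block-cop p∈j j≢B)

    avoiding-class : ∀ {j y} → ¬ p ∈ᵇ j → inj₂ j ≈ y → Avoids p y
    avoiding-class {y = inj₁ _}  _   j≈w = ¬block≈point j≈w
    avoiding-class {y = inj₂ j′} p∉j j≈j′ p∈j′ =
      p∉j (subst (p ∈ᵇ_) (inj₂-injective (located-sym (p-block-located p∈j′) j≈j′)) p∈j′)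

    located-or-avoiding : ∀ x → Located x ⊎ (∀ y → x ≈ y → Avoids p y)
    located-or-avoiding (inj₁ u) = inj₁ (point-located u)
    located-or-avoiding (inj₂ j) with p ∈ᵇ? j
    ... | yes p∈j = inj₁ (p-block-located p∈j)
    ... | no  p∉j = inj₂ λ _ → avoiding-class p∉j

    probe-round : ∀ {S} →
      (∀ x → S x → (∀ y → x ≈ y → Avoids p y) → CopsWin G (2 * r + k ∸ 3) (N[ G ] (Class G S cops x))) →
      CopsWin G (2 * r + k ∸ 3) S
    probe-round continue =
      probe cops λ x Sx → Sum.map Located⇒AtMostOne (continue x Sx) (located-or-avoiding x)

  BlocksWithin : ℕ → (V → Set) → Set
  BlocksWithin n S = ∀ j → S (inj₂ j) → ∀ x → x ∈ᵇ j → toℕ x < n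

  BlocksWithin-zero : ∀ {S} → 0 < k → BlocksWithin 0 S → ∀ j → ¬ S (inj₂ j)
  BlocksWithin-zero 0<k within j Sj with point-of 0<k j
  ... | x , x∈j = contradiction (within j Sj x x∈j) λ ()

  BlocksWithin-avoid : ∀ {n C} (n<v : n < v) → BlocksWithin (suc n) C →
                       (∀ y → C y → Avoids (fromℕ< n<v) y) → BlocksWithin n (N[ G ] C)
  BlocksWithin-avoid n<v within avoid j (_ , Cj , inj₁ refl) x x∈j =
    ≤∧≢⇒< (s≤s⁻¹ (within j Cj x x∈j)) λ x≡n →
      avoid (inj₂ j) Cj (subst (_∈ᵇ j) (toℕ-injective (trans x≡n (sym (toℕ-fromℕ< n<v)))) x∈j)
  BlocksWithin-avoid n<v within avoid j (inj₁ u , Cu , inj₂ _) = ⊥-elim (avoid (inj₁ u) Cu)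

  capture : 1 < v → 0 < k → ∀ n → n ≤ v → ∀ S → BlocksWithin n S → CopsWin G (2 * r + k ∸ 3) S
  capture 1<v 0<k zero _ S within = probe-round λ x Sx avoid → ⊥-elim (not-hidden x Sx avoid)
    where
    p : Fin v
    p = fromℕ< (≤-trans (s≤s z≤n) 1<v)
    open Probe p (proj₁ (other-than 1<v p)) (proj₂ (other-than 1<v p))
    not-hidden : ∀ x → S x → ¬ (∀ y → x ≈ y → Avoids p y)
    not-hidden (inj₁ u) _  avoid = avoid (inj₁ u) ≈-refl
    not-hidden (inj₂ j) Sj _     = BlocksWithin-zero {S} 0<k within j Sj
  capture 1<v 0<k (suc n) n<v S within = probe-round λ x Sx avoid →
    capture 1<v 0<k n (<⇒≤ n<v) _
      (BlocksWithin-avoid n<v (λ j Cj → within j (proj₁ Cj)) (λ y Cy → avoid y (proj₂ Cy)))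
    where
    p : Fin v
    p = fromℕ< n<v
    open Probe p (proj₁ (other-than 1<v p)) (proj₂ (other-than 1<v p))

  few-points⇒AtMostOne : v ≤ 1 → 1 < k → AtMostOne G (λ _ → ⊤)
  few-points⇒AtMostOne v≤1 1<k (inj₂ j) _        _ _ = ⊥-elim (v≤1⇒¬block v≤1 1<k j)
  few-points⇒AtMostOne v≤1 1<k _        (inj₂ j) _ _ = ⊥-elim (v≤1⇒¬block v≤1 1<k j)
  few-points⇒AtMostOne v≤1 1<k (inj₁ x) (inj₁ y) _ _ =
    cong inj₁ (toℕ-injective (trans (toℕ≡0 x) (sym (toℕ≡0 y))))
    where
    toℕ≡0 : (x : Fin v) → toℕ x ≡ 0
    toℕ≡0 x = n<1⇒n≡0 (≤-trans (toℕ<n x) v≤1)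

corollary2p5 : (v b r k : ℕ) (blocks : Fin b → Subset v) →
    2 ≤ k → IsBIBD v b r k 1 blocks →
    ζ≤ (incidenceGraph blocks) (2 * r + k ∸ 3)
corollary2p5 v b r k blocks 1<k bibd with v ≤? 1
... | yes v≤1 = 0 , z≤n , AtMostOne⇒CopsWin G (few-points⇒AtMostOne v≤1 1<k)
  where open Design blocks bibd
... | no  v≰1 = _ , ≤-refl , capture (≰⇒> v≰1) (≤-trans (s≤s z≤n) 1<k) v ≤-refl _ (λ _ _ x _ → toℕ<n x)
  where open Design blocks bibd
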